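{- For every pair of integers $a,b\geq 2$, there is a unique $n\geq 3$ such that there is a smooth arithmetical structure on $D_n$ with $\bar r_x=a$ and $\bar r_y=b$. Moreover, this smooth arithmetical structure on $D_n$ with $\bar r_x=a$ and $\bar r_y=b$ is unique.
   Context: For $n\ge 3$ let $\ell=n-3$. The bident $D_n$ has vertices $v_x,v_y,v_0,\dots,v_\ell$ and edges $v_xv_0$, $v_yv_0$, $v_iv_{i+1}$ ($0\le i\le\ell-1$). An arithmetical structure on $D_n$ is a pair $(\mathbf d,\mathbf r)$, $\mathbf d=(d_x,d_y,d_0,\dots,d_\ell)$, $\mathbf r=(r_x,r_y,r_0,\dots,r_\ell)$, of positive integer vectors with $(\operatorname{diag}(\mathbf d)-A)\mathbf r=\mathbf 0$ ($A$ the adjacency matrix) and $\mathbf r$ primitive. It is smooth if $d_x,d_y,d_1,\dots,d_\ell\ge2$. For such a structure, $\bar{\mathbf r}=\frac{r_0}{r_xr_y}\mathbf r$, an integer vector with $\bar r_x\bar r_y=\bar r_0$. -}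

module Defs where

open import Data.Nat using (ℕ; zero; suc; _+_; _*_; _≤_; _<_; _≟_)
open import Data.Nat.Divisibility using (_∣_)
open import Data.Fin using (Fin; toℕ)
open import Data.List using (List; _∷_; map)
open import Data.Nat.ListAction using (sum)
open import Data.List.Base using (allFin)
open import Data.Bool using (Bool; true; false; _∨_)
open import Data.Product using (_×_)
open import Relation.Nullary.Decidable using (⌊_⌋)
open import Relation.Binary.PropositionalEquality using (_≡_)

-- Vertices of the bident D_n with n = ℓ + 3:
-- vx, vy, and the path vertices v_0, …, v_ℓ (indexed by Fin (suc ℓ)).
data Vert (ℓ : ℕ) : Set where
  vx : Vert ℓ
  vy : Vert ℓ
  vp : Fin (suc ℓ) → Vert ℓ

vertices : (ℓ : ℕ) → List (Vert ℓ)
vertices ℓ = vx ∷ vy ∷ map vp (allFin (suc ℓ))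

adj : {ℓ : ℕ} → Vert ℓ → Vert ℓ → Bool
adj vx vx = false
adj vx vy = false
adj vx (vp j) = ⌊ toℕ j ≟ 0 ⌋
adj vy vx = false
adj vy vy = false
adj vy (vp j) = ⌊ toℕ j ≟ 0 ⌋
adj (vp i) vx = ⌊ toℕ i ≟ 0 ⌋
adj (vp i) vy = ⌊ toℕ i ≟ 0 ⌋
adj (vp i) (vp j) = ⌊ suc (toℕ i) ≟ toℕ j ⌋ ∨ ⌊ suc (toℕ j) ≟ toℕ i ⌋

A : {ℓ : ℕ} → Vert ℓ → Vert ℓ → ℕ
A v w with adj v w
... | true = 1
... | false = 0

Ar : {ℓ : ℕ} → (Vert ℓ → ℕ) → Vert ℓ → ℕ
Ar {ℓ} r v = sum (map (λ w → A v w * r w) (vertices ℓ))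

Primitive : {ℓ : ℕ} → (Vert ℓ → ℕ) → Set
Primitive {ℓ} r = ∀ k → (∀ v → k ∣ r v) → k ≡ 1

-- Arithmetical structure (d, r) on D_{ℓ+3}: positive integer vectors,
-- (diag(d) − A) r = 0 (written as d_v r_v = (A r)_v), and r primitive.
IsArithmetical : (ℓ : ℕ) → (Vert ℓ → ℕ) → (Vert ℓ → ℕ) → Set
IsArithmetical ℓ d r =
  (∀ v → 1 ≤ d v) × (∀ v → 1 ≤ r v) × (∀ v → d v * r v ≡ Ar r v) × Primitive r

IsSmooth : (ℓ : ℕ) → (Vert ℓ → ℕ) → Set
IsSmooth ℓ d = 2 ≤ d vx × 2 ≤ d vy × (∀ i → 1 ≤ toℕ i → 2 ≤ d (vp i))

-- r̄ = (r_0 / (r_x r_y)) r, so r̄_x = r_0 / r_y and r̄_y = r_0 / r_x.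
-- r̄_x = a  ⇔  a * r_y = r_0 ;  r̄_y = b  ⇔  b * r_x = r_0.
RBarX≡ : {ℓ : ℕ} → (Vert ℓ → ℕ) → ℕ → Set
RBarX≡ r a = a * r vy ≡ r (vp Data.Fin.zero)

RBarY≡ : {ℓ : ℕ} → (Vert ℓ → ℕ) → ℕ → Set
RBarY≡ r b = b * r vx ≡ r (vp Data.Fin.zero)

Good : (a b ℓ : ℕ) → (Vert ℓ → ℕ) → (Vert ℓ → ℕ) → Set
Good a b ℓ d r = IsArithmetical ℓ d r × IsSmooth ℓ d × RBarX≡ r a × RBarY≡ r b

module Submission where

-- Write x = r_x, y = r_y and r₀, r₁, … for the path values.  The equations at v_x and v_y
-- say b x = r₀ = a y, and since a, b ≥ 2 this gives x + y ≤ r₀.  Along the path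
-- d_i r_i = r_{i+1} + r_{i-1} with d_i ≥ 2 and r_{ℓ+1} = 0, so the path values strictly
-- decrease; in particular r₁ < r₀, and then d₀ r₀ = x + y + r₁ < 2 r₀ forces d₀ = 1.
-- Primitivity makes x, y coprime, so b x = a y pins them down, and with them r₀ and
-- r₁ = r₀ − x − y.  From then on r_{i+1} = d_i r_i − r_{i-1} with 0 ≤ r_{i+1} < r_i, so
-- d_i is the ceiling of r_{i-1}/r_i: the whole structure, including where the path
-- ends, is determined.  Running the same ceiling-division recursion from
-- x = a / gcd(a,b), y = b / gcd(a,b) constructs it.

open import Algebra.Properties.CommutativeSemigroup using (interchange)
open import Data.Empty using (⊥; ⊥-elim)
open import Data.Fin as Fin using (Fin; toℕ; fromℕ<)
open import Data.Fin.Properties using (toℕ<n; toℕ-fromℕ<)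
open import Data.List using (map; tabulate)
open import Data.List.Base using (allFin)
open import Data.List.Properties using (map-cong; map-∘; map-tabulate)
open import Data.Nat
open import Data.Nat.Coprimality using (Coprime; coprime-divisor; coprime-/gcd)
open import Data.Nat.Divisibility
open import Data.Nat.DivMod using (_/_; _%_; m≡m%n+[m/n]*n; m%n<n; *-/-assoc)
open import Data.Nat.GCD using (gcd; gcd[m,n]∣m; gcd[m,n]∣n; gcd[m,n]≢0; m/gcd[m,n]≢0; n/gcd[m,n]≢0)
open import Data.Nat.Induction using (<-rec)
open import Data.Nat.ListAction using (sum)
open import Data.Nat.Properties
open import Data.Product using (Σ; _×_; _,_; proj₁; proj₂; ∃; ∃₂)
open import Data.Sum using (inj₁)
open import Defs
open import Function using (_∘_; id; const)
open import Relation.Binary using (tri<; tri≈; tri>)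
open import Relation.Binary.PropositionalEquality hiding (J)
open import Relation.Nullary using (yes; no)


∑< : ℕ → (ℕ → ℕ) → ℕ
∑< zero    F = 0
∑< (suc n) F = F 0 + ∑< n (F ∘ suc)

sum-allFin : ∀ n (F : ℕ → ℕ) → sum (map (F ∘ toℕ) (allFin n)) ≡ ∑< n F
sum-allFin zero    F = refl
sum-allFin (suc n) F = cong (F 0 +_) (begin
  sum (map (F ∘ toℕ) (tabulate (Fin.suc {n})))  ≡⟨ cong sum (map-tabulate {n = n} Fin.suc (F ∘ toℕ)) ⟩
  sum (tabulate (F ∘ suc ∘ toℕ {n}))           ≡⟨ cong sum (map-tabulate {n = n} id (F ∘ suc ∘ toℕ)) ⟨
  sum (map (F ∘ suc ∘ toℕ) (allFin n))          ≡⟨ sum-allFin n (F ∘ suc) ⟩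
  ∑< n (F ∘ suc)                                ∎)
  where open ≡-Reasoning

∑<-zero : ∀ n → ∑< n (const 0) ≡ 0
∑<-zero zero    = refl
∑<-zero (suc n) = ∑<-zero n

∑<-distrib-+ : ∀ n (F G : ℕ → ℕ) → ∑< n (λ m → F m + G m) ≡ ∑< n F + ∑< n G
∑<-distrib-+ zero    F G = refl
∑<-distrib-+ (suc n) F G = begin
  F 0 + G 0 + ∑< n (λ m → F (suc m) + G (suc m))  ≡⟨ cong (F 0 + G 0 +_) (∑<-distrib-+ n (F ∘ suc) (G ∘ suc)) ⟩
  F 0 + G 0 + (∑< n (F ∘ suc) + ∑< n (G ∘ suc))   ≡⟨ interchange +-commutativeSemigroup (F 0) (G 0) _ _ ⟩
  F 0 + ∑< n (F ∘ suc) + (G 0 + ∑< n (G ∘ suc))   ∎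
  where open ≡-Reasoning

δ : ℕ → ℕ → ℕ → ℕ
δ zero    zero    x = x
δ zero    (suc m) x = 0
δ (suc c) zero    x = 0
δ (suc c) (suc m) x = δ c m x

δ-≡ : ∀ {c m} x → m ≡ c → δ c m x ≡ x
δ-≡ {zero}  x refl = refl
δ-≡ {suc c} x refl = δ-≡ {c} x refl

δ-≢ : ∀ {c m} x → m ≢ c → δ c m x ≡ 0
δ-≢ {zero}  {zero}  x m≢c = ⊥-elim (m≢c refl)
δ-≢ {zero}  {suc m} x m≢c = refl
δ-≢ {suc c} {zero}  x m≢c = refl
δ-≢ {suc c} {suc m} x m≢c = δ-≢ x (m≢c ∘ cong suc)

∑<-δ : ∀ n c (F : ℕ → ℕ) → (n ≤ c → F c ≡ 0) → ∑< n (λ m → δ c m (F m)) ≡ F c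
∑<-δ zero    c       F F-beyond = sym (F-beyond z≤n)
∑<-δ (suc n) zero    F F-beyond = trans (cong (F 0 +_) (∑<-zero n)) (+-identityʳ (F 0))
∑<-δ (suc n) (suc c) F F-beyond = ∑<-δ n c (F ∘ suc) (F-beyond ∘ s≤s)

-- Values along the path, extended by zero beyond v_ℓ

zeroExtend : ∀ {n} → (Fin n → ℕ) → ℕ → ℕ
zeroExtend {zero}  f m       = 0
zeroExtend {suc n} f zero    = f Fin.zero
zeroExtend {suc n} f (suc m) = zeroExtend (f ∘ Fin.suc) m

zeroExtend-toℕ : ∀ {n} (f : Fin n → ℕ) i → zeroExtend f (toℕ i) ≡ f i
zeroExtend-toℕ f Fin.zero    = refl
zeroExtend-toℕ f (Fin.suc i) = zeroExtend-toℕ (f ∘ Fin.suc) i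

zeroExtend-< : ∀ {n m} (f : Fin n → ℕ) (m<n : m < n) → zeroExtend f m ≡ f (fromℕ< m<n)
zeroExtend-< {suc n} {zero}  f _   = refl
zeroExtend-< {suc n} {suc m} f m<n = zeroExtend-< (f ∘ Fin.suc) (s<s⁻¹ m<n)

zeroExtend-≥ : ∀ {n m} (f : Fin n → ℕ) → n ≤ m → zeroExtend f m ≡ 0
zeroExtend-≥ {zero}  f _         = refl
zeroExtend-≥ {suc n} f (s≤s n≤m) = zeroExtend-≥ (f ∘ Fin.suc) n≤m

zeroExtend-restrict : ∀ {n} (R : ℕ → ℕ) → (∀ {m} → n ≤ m → R m ≡ 0) → zeroExtend (R ∘ toℕ {n}) ≗ R
zeroExtend-restrict {zero}  R R-beyond m       = sym (R-beyond z≤n)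
zeroExtend-restrict {suc n} R R-beyond zero    = refl
zeroExtend-restrict {suc n} R R-beyond (suc m) = zeroExtend-restrict {n} (R ∘ suc) (R-beyond ∘ s≤s) m

onPath : ∀ {ℓ} → (Vert ℓ → ℕ) → ℕ → ℕ
onPath f = zeroExtend (f ∘ vp)

Vert-ext : ∀ {ℓ} {f g : Vert ℓ → ℕ} → f vx ≡ g vx → f vy ≡ g vy → onPath f ≗ onPath g → ∀ v → f v ≡ g v
Vert-ext fx≡gx fy≡gy path≗ vx     = fx≡gx
Vert-ext fx≡gx fy≡gy path≗ vy     = fy≡gy
Vert-ext {f = f} {g} fx≡gx fy≡gy path≗ (vp j) = begin
  f (vp j)                     ≡⟨ zeroExtend-toℕ (f ∘ vp) j ⟨
  onPath f (toℕ j)             ≡⟨ path≗ (toℕ j) ⟩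
  onPath g (toℕ j)             ≡⟨ zeroExtend-toℕ (g ∘ vp) j ⟩
  g (vp j)                     ∎
  where open ≡-Reasoning

A-path : ∀ {ℓ} (j i : Fin (suc ℓ)) y →
  A (vp j) (vp i) * y ≡ δ (suc (toℕ j)) (toℕ i) y + δ (toℕ j) (suc (toℕ i)) y
A-path j i y with suc (toℕ j) ≟ toℕ i | suc (toℕ i) ≟ toℕ j
... | yes p | yes q = ⊥-elim (m+1+n≢n 1 (trans (cong suc p) q))
... | yes p | no _  = sym (cong₂ _+_ (δ-≡ y (sym p)) (δ-≢ y (m+1+n≢n 1 ∘ trans (cong suc p))))
... | no _  | yes q = trans (+-identityʳ y)
                        (sym (cong₂ _+_ (δ-≢ y (m+1+n≢n 1 ∘ sym ∘ trans (sym q) ∘ cong suc)) (δ-≡ y q)))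
... | no p  | no q  = sym (cong₂ _+_ (δ-≢ y (p ∘ sym)) (δ-≢ y q))

sum-map-vp : ∀ {ℓ} (g : Vert ℓ → ℕ) →
  sum (map g (map vp (allFin (suc ℓ)))) ≡ sum (map (g ∘ vp) (allFin (suc ℓ)))
sum-map-vp {ℓ} g = cong sum (sym (map-∘ (allFin (suc ℓ))))

module _ {ℓ : ℕ} (r : Vert ℓ → ℕ) where
  open ≡-Reasoning

  Ar-vx : Ar r vx ≡ onPath r 0
  Ar-vx = begin
    Ar r vx                                                          ≡⟨ sum-map-vp (λ w → A vx w * r w) ⟩
    sum (map (λ i → A vx (vp i) * r (vp i)) (allFin (suc ℓ)))        ≡⟨ cong sum (map-cong leaf (allFin (suc ℓ))) ⟩
    sum (map (λ i → δ 0 (toℕ i) (onPath r (toℕ i))) (allFin (suc ℓ))) ≡⟨ sum-allFin (suc ℓ) (λ m → δ 0 m (onPath r m)) ⟩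
    ∑< (suc ℓ) (λ m → δ 0 m (onPath r m))                             ≡⟨ ∑<-δ (suc ℓ) 0 (onPath r) (λ ()) ⟩
    onPath r 0                                                       ∎
    where
    leaf : ∀ i → A vx (vp i) * r (vp i) ≡ δ 0 (toℕ i) (onPath r (toℕ i))
    leaf Fin.zero    = *-identityˡ _
    leaf (Fin.suc i) = refl

  Ar-vy : Ar r vy ≡ onPath r 0
  Ar-vy = trans (cong sum (map-cong same-neighbours (vertices ℓ))) Ar-vx
    where
    same-neighbours : ∀ w → A vy w * r w ≡ A vx w * r w
    same-neighbours vx                = refl
    same-neighbours vy                = refl
    same-neighbours (vp Fin.zero)     = refl
    same-neighbours (vp (Fin.suc j))  = refl

  -- The second summand is r at the predecessor of v_j, or 0 if j = 0.
  ∑-path-neighbours : ∀ j → sum (map (λ w → A (vp j) w * r w) (map vp (allFin (suc ℓ)))) ≡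
                      onPath r (suc (toℕ j)) + ∑< (suc ℓ) (λ m → δ (toℕ j) (suc m) (onPath r m))
  ∑-path-neighbours j = begin
    sum (map (λ w → A (vp j) w * r w) (map vp (allFin (suc ℓ))))     ≡⟨ sum-map-vp (λ w → A (vp j) w * r w) ⟩
    sum (map (λ i → A (vp j) (vp i) * r (vp i)) (allFin (suc ℓ)))     ≡⟨ cong sum (map-cong neighbour (allFin (suc ℓ))) ⟩
    sum (map (G ∘ toℕ) (allFin (suc ℓ)))                               ≡⟨ sum-allFin (suc ℓ) G ⟩
    ∑< (suc ℓ) G                                                       ≡⟨ ∑<-distrib-+ (suc ℓ) (λ m → δ (suc J) m (R m)) (λ m → δ J (suc m) (R m)) ⟩
    ∑< (suc ℓ) (λ m → δ (suc J) m (R m)) + ∑< (suc ℓ) (λ m → δ J (suc m) (R m))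
      ≡⟨ cong (_+ ∑< (suc ℓ) (λ m → δ J (suc m) (R m))) (∑<-δ (suc ℓ) (suc J) R (zeroExtend-≥ (r ∘ vp))) ⟩
    R (suc J) + ∑< (suc ℓ) (λ m → δ J (suc m) (R m))                   ∎
    where
    J = toℕ j
    R = onPath r
    G : ℕ → ℕ
    G m = δ (suc J) m (R m) + δ J (suc m) (R m)
    neighbour : ∀ i → A (vp j) (vp i) * r (vp i) ≡ G (toℕ i)
    neighbour i = trans (cong (A (vp j) (vp i) *_) (sym (zeroExtend-toℕ (r ∘ vp) i))) (A-path j i (R (toℕ i)))

  Ar-v₀ : Ar r (vp Fin.zero) ≡ r vx + (r vy + onPath r 1)
  Ar-v₀ = cong₂ _+_ (*-identityˡ (r vx)) (cong₂ _+_ (*-identityˡ (r vy)) (begin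
    sum (map (λ w → A (vp Fin.zero) w * r w) (map vp (allFin (suc ℓ))))  ≡⟨ ∑-path-neighbours Fin.zero ⟩
    onPath r 1 + ∑< (suc ℓ) (const 0)                                     ≡⟨ cong (onPath r 1 +_) (∑<-zero (suc ℓ)) ⟩
    onPath r 1 + 0                                                        ≡⟨ +-identityʳ _ ⟩
    onPath r 1                                                            ∎))

  Ar-vsuc : ∀ j → Ar r (vp (Fin.suc j)) ≡ onPath r (2 + toℕ j) + onPath r (toℕ j)
  Ar-vsuc j = trans (∑-path-neighbours (Fin.suc j))
    (cong (onPath r (2 + toℕ j) +_) (∑<-δ (suc ℓ) (toℕ j) (onPath r) (zeroExtend-≥ (r ∘ vp))))

-- Smooth structures on a path with a free end

-- Values R and degrees D along a path v₀, …, v_ℓ; the end v₀ carries no equation, so D 0 is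
-- irrelevant.
record SmoothPath (ℓ : ℕ) (R D : ℕ → ℕ) : Set where
  field
    positive  : ∀ {m} → m ≤ ℓ → 0 < R m
    vanishing : ∀ {m} → ℓ < m → R m ≡ 0
    balanced  : ∀ {m} → suc m ≤ ℓ → D (suc m) * R (suc m) ≡ R (2 + m) + R m
    smooth    : ∀ {m} → suc m ≤ ℓ → 2 ≤ D (suc m)

induction₂ : ∀ {p} (P : ℕ → Set p) → P 0 → P 1 → (∀ {m} → P m → P (suc m) → P (2 + m)) → ∀ m → P m
induction₂ P P0 P1 step m = proj₁ (consecutive m)
  where
  consecutive : ∀ m → P m × P (suc m)
  consecutive zero    = P0 , P1
  consecutive (suc m) = let Pm , Psm = consecutive m in Psm , step Pm Psm

descent-step : ∀ {D x y z} → 2 ≤ D → D * x ≡ z + y → z < x → x < y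
descent-step {D} {x} {y} {z} 2≤D Dx≡z+y z<x = +-cancelˡ-< x x y (begin-strict
  x + x      ≡⟨ cong (x +_) (+-identityʳ x) ⟨
  2 * x      ≤⟨ *-monoˡ-≤ x 2≤D ⟩
  D * x      ≡⟨ Dx≡z+y ⟩
  z + y      <⟨ +-monoˡ-< y z<x ⟩
  x + y      ∎)
  where open ≤-Reasoning

module _ {ℓ : ℕ} {R D : ℕ → ℕ} (C : SmoothPath ℓ R D) where
  open SmoothPath C

  decreasing : ∀ {m} → m ≤ ℓ → R (suc m) < R m
  decreasing {m} m≤ℓ = decreasing-at (ℓ ∸ m) (m+[n∸m]≡n m≤ℓ)
    where
    decreasing-at : ∀ k {m} → m + k ≡ ℓ → R (suc m) < R m
    decreasing-at zero {m} m+0≡ℓ =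
      subst (_< R m) (sym (vanishing (≤-reflexive (cong suc (sym m≡ℓ))))) (positive (≤-reflexive m≡ℓ))
      where
      m≡ℓ : m ≡ ℓ
      m≡ℓ = trans (sym (+-identityʳ m)) m+0≡ℓ
    decreasing-at (suc k) {m} m+k+1≡ℓ =
      descent-step (smooth 1+m≤ℓ) (balanced 1+m≤ℓ) (decreasing-at k 1+m+k≡ℓ)
      where
      1+m+k≡ℓ : suc m + k ≡ ℓ
      1+m+k≡ℓ = trans (sym (+-suc m k)) m+k+1≡ℓ
      1+m≤ℓ : suc m ≤ ℓ
      1+m≤ℓ = subst (suc m ≤_) 1+m+k≡ℓ (m≤m+n (suc m) k)

  support : ∀ {m} → 0 < R m → m ≤ ℓ
  support 0<Rm = ≮⇒≥ (λ ℓ<m → <-irrefl (sym (vanishing ℓ<m)) 0<Rm)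

  ∣-everywhere : ∀ {k} → k ∣ R 0 → k ∣ R 1 → ∀ m → k ∣ R m
  ∣-everywhere {k} k∣R0 k∣R1 = induction₂ (λ m → k ∣ R m) k∣R0 k∣R1 step
    where
    step : ∀ {m} → k ∣ R m → k ∣ R (suc m) → k ∣ R (2 + m)
    step {m} k∣Rm k∣R1+m with suc m ≤? ℓ
    ... | yes 1+m≤ℓ = ∣m+n∣m⇒∣n (subst (k ∣_) (trans (balanced 1+m≤ℓ) (+-comm _ (R m))) (∣n⇒∣m*n (D (suc m)) k∣R1+m)) k∣Rm
    ... | no  1+m≰ℓ = subst (k ∣_) (sym (vanishing (m≤n⇒m≤1+n (≰⇒> 1+m≰ℓ)))) (k ∣0)

ceilDivMod-quotient-≮ : ∀ {D D′ x y y′ c} → D < D′ → D * x ≡ y + c → D′ * x ≡ y′ + c → y′ < x → ⊥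
ceilDivMod-quotient-≮ {D} {D′} {x} {y} {y′} {c} D<D′ e e′ y′<x = <-irrefl refl (begin-strict
  y′ + c          <⟨ +-monoˡ-< c y′<x ⟩
  x + c           ≤⟨ +-monoʳ-≤ x (m≤n+m c y) ⟩
  x + (y + c)     ≡⟨ cong (x +_) e ⟨
  suc D * x       ≤⟨ *-monoˡ-≤ x D<D′ ⟩
  D′ * x          ≡⟨ e′ ⟩
  y′ + c          ∎)
  where open ≤-Reasoning

ceilDivMod-unique : ∀ {D₁ D₂ x y₁ y₂ c} → D₁ * x ≡ y₁ + c → D₂ * x ≡ y₂ + c → y₁ < x → y₂ < x →
                    D₁ ≡ D₂ × y₁ ≡ y₂
ceilDivMod-unique {D₁} {D₂} {c = c} e₁ e₂ y₁<x y₂<x with <-cmp D₁ D₂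
... | tri< D₁<D₂ _ _ = ⊥-elim (ceilDivMod-quotient-≮ D₁<D₂ e₁ e₂ y₂<x)
... | tri≈ _ refl _  = refl , +-cancelʳ-≡ c _ _ (trans (sym e₁) e₂)
... | tri> _ _ D₂<D₁ = ⊥-elim (ceilDivMod-quotient-≮ D₂<D₁ e₂ e₁ y₁<x)

module SmoothPath-unique {ℓ₁ ℓ₂ : ℕ} {R₁ D₁ R₂ D₂ : ℕ → ℕ}
                         (C₁ : SmoothPath ℓ₁ R₁ D₁) (C₂ : SmoothPath ℓ₂ R₂ D₂)
                         (R₁0≡R₂0 : R₁ 0 ≡ R₂ 0) (R₁1≡R₂1 : R₁ 1 ≡ R₂ 1) where
  open SmoothPath

  private
    next-unique : ∀ {m} → R₁ m ≡ R₂ m → R₁ (suc m) ≡ R₂ (suc m) → suc m ≤ ℓ₁ →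
                  D₁ (suc m) ≡ D₂ (suc m) × R₁ (2 + m) ≡ R₂ (2 + m)
    next-unique {m} e e′ 1+m≤ℓ₁ = ceilDivMod-unique (balanced C₁ 1+m≤ℓ₁) balanced₂
      (decreasing C₁ 1+m≤ℓ₁) (subst (R₂ (2 + m) <_) (sym e′) (decreasing C₂ 1+m≤ℓ₂))
      where
      1+m≤ℓ₂ : suc m ≤ ℓ₂
      1+m≤ℓ₂ = support C₂ (subst (0 <_) e′ (positive C₁ 1+m≤ℓ₁))
      balanced₂ : D₂ (suc m) * R₁ (suc m) ≡ R₂ (2 + m) + R₁ m
      balanced₂ = subst₂ (λ u v → D₂ (suc m) * u ≡ R₂ (2 + m) + v) (sym e′) (sym e) (balanced C₂ 1+m≤ℓ₂)

  R₁≗R₂ : R₁ ≗ R₂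
  R₁≗R₂ = induction₂ (λ m → R₁ m ≡ R₂ m) R₁0≡R₂0 R₁1≡R₂1 step
    where
    step : ∀ {m} → R₁ m ≡ R₂ m → R₁ (suc m) ≡ R₂ (suc m) → R₁ (2 + m) ≡ R₂ (2 + m)
    step {m} e e′ with suc m ≤? ℓ₁
    ... | yes 1+m≤ℓ₁ = proj₂ (next-unique e e′ 1+m≤ℓ₁)
    ... | no  1+m≰ℓ₁ = trans (vanishing C₁ (m≤n⇒m≤1+n ℓ₁<1+m)) (sym (vanishing C₂ (m≤n⇒m≤1+n ℓ₂<1+m)))
      where
      ℓ₁<1+m : ℓ₁ < suc m
      ℓ₁<1+m = ≰⇒> 1+m≰ℓ₁
      ℓ₂<1+m : ℓ₂ < suc m
      ℓ₂<1+m = ≰⇒> λ 1+m≤ℓ₂ → <-irrefl (trans (sym (vanishing C₁ ℓ₁<1+m)) e′) (positive C₂ 1+m≤ℓ₂)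

  ℓ₁≡ℓ₂ : ℓ₁ ≡ ℓ₂
  ℓ₁≡ℓ₂ = ≤-antisym (support C₂ (subst (0 <_) (R₁≗R₂ ℓ₁) (positive C₁ ≤-refl)))
                    (support C₁ (subst (0 <_) (sym (R₁≗R₂ ℓ₂)) (positive C₂ ≤-refl)))

  D₁≡D₂ : ∀ {m} → suc m ≤ ℓ₁ → D₁ (suc m) ≡ D₂ (suc m)
  D₁≡D₂ {m} 1+m≤ℓ₁ = proj₁ (next-unique (R₁≗R₂ m) (R₁≗R₂ (suc m)) 1+m≤ℓ₁)

ceilDivMod : ∀ p n → .{{NonZero n}} → ∃₂ λ D s → s < n × D * n ≡ s + p
ceilDivMod p n with p % n | m≡m%n+[m/n]*n p n | m%n<n p n
... | zero  | p≡[p/n]*n | _       = p / n , 0 , >-nonZero⁻¹ n , sym p≡[p/n]*n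
... | suc t | p≡t+[p/n]*n | t<n = suc (p / n) , n ∸ suc t , ∸-monoʳ-< z<s (<⇒≤ t<n) , (begin
  n + p / n * n                ≡⟨ cong (_+ p / n * n) (m∸n+n≡m (<⇒≤ t<n)) ⟨
  n ∸ suc t + suc t + p / n * n  ≡⟨ +-assoc (n ∸ suc t) (suc t) _ ⟩
  n ∸ suc t + (suc t + p / n * n) ≡⟨ cong (n ∸ suc t +_) p≡t+[p/n]*n ⟨
  n ∸ suc t + p                ∎)
  where open ≡-Reasoning

ceilDiv≥2 : ∀ {D n s p} → D * n ≡ s + p → n < p → 2 ≤ D
ceilDiv≥2 {D} {n} {s} {p} Dn≡s+p n<p = ≰⇒> λ D≤1 → <-irrefl Dn≡s+p (begin-strict
  D * n    ≤⟨ *-monoˡ-≤ n D≤1 ⟩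
  1 * n    ≡⟨ *-identityˡ n ⟩
  n        <⟨ n<p ⟩
  p        ≤⟨ m≤n+m p s ⟩
  s + p    ∎)
  where open ≤-Reasoning

_◂_ : ℕ → (ℕ → ℕ) → ℕ → ℕ
(x ◂ f) zero    = x
(x ◂ f) (suc m) = f m

smoothPath-end : ∀ {p} D → 0 < p → SmoothPath 0 (p ◂ const 0) D
smoothPath-end D 0<p = record
  { positive  = λ { z≤n → 0<p }
  ; vanishing = λ { {suc m} _ → refl }
  ; balanced  = λ ()
  ; smooth    = λ ()
  }

smoothPath-cons : ∀ {ℓ R D p E} → SmoothPath ℓ R D → 0 < p → 2 ≤ E → E * R 0 ≡ R 1 + p →
                  SmoothPath (suc ℓ) (p ◂ R) (0 ◂ (E ◂ (D ∘ suc)))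
smoothPath-cons {ℓ} {R} {D} {p} {E} C 0<p 2≤E balanced₁ = record
  { positive  = positive′
  ; vanishing = λ { {suc m} (s≤s ℓ<m) → vanishing ℓ<m }
  ; balanced  = balanced′
  ; smooth    = smooth′
  }
  where
  open SmoothPath C
  positive′ : ∀ {m} → m ≤ suc ℓ → 0 < (p ◂ R) m
  positive′ {zero}  _         = 0<p
  positive′ {suc m} (s≤s m≤ℓ) = positive m≤ℓ
  balanced′ : ∀ {m} → suc m ≤ suc ℓ → (0 ◂ (E ◂ (D ∘ suc))) (suc m) * (p ◂ R) (suc m) ≡ (p ◂ R) (2 + m) + (p ◂ R) m
  balanced′ {zero}  _          = balanced₁
  balanced′ {suc m} (s≤s 1+m≤ℓ) = balanced 1+m≤ℓ
  smooth′ : ∀ {m} → suc m ≤ suc ℓ → 2 ≤ (0 ◂ (E ◂ (D ∘ suc))) (suc m)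
  smooth′ {zero}  _           = 2≤E
  smooth′ {suc m} (s≤s 1+m≤ℓ) = smooth 1+m≤ℓ

SmoothPathFrom : ℕ → ℕ → Set
SmoothPathFrom p q = ∃ λ ℓ → ∃₂ λ R D → SmoothPath ℓ R D × R 0 ≡ p × R 1 ≡ q

smoothPath-exists : ∀ q {p} → q < p → SmoothPathFrom p q
smoothPath-exists = <-rec (λ q → ∀ {p} → q < p → SmoothPathFrom p q) prepend
  where
  prepend : ∀ q → (∀ {q′} → q′ < q → ∀ {p} → q′ < p → SmoothPathFrom p q′) → ∀ {p} → q < p → SmoothPathFrom p q
  prepend zero    _       0<p = 0 , _ , const 0 , smoothPath-end (const 0) 0<p , refl , refl
  prepend (suc q) extend {p} 1+q<p with ceilDivMod p (suc q)
  ... | E , s , s<1+q , E[1+q]≡s+p with extend s<1+q s<1+q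
  ...   | ℓ , R , D , C , R0≡1+q , R1≡s =
    suc ℓ , p ◂ R , 0 ◂ (E ◂ (D ∘ suc)) ,
    smoothPath-cons C (<-trans z<s 1+q<p) (ceilDiv≥2 E[1+q]≡s+p 1+q<p)
      (subst₂ (λ u v → E * u ≡ v + p) (sym R0≡1+q) (sym R1≡s) E[1+q]≡s+p) ,
    refl , R0≡1+q

leaves≤hub : ∀ {a b x y c} → 2 ≤ a → 2 ≤ b → b * x ≡ c → a * y ≡ c → x + y ≤ c
leaves≤hub {a} {b} {x} {y} {c} a≥2 b≥2 bx≡c ay≡c = *-cancelˡ-≤ 2 (begin
  2 * (x + y)      ≡⟨ *-distribˡ-+ 2 x y ⟩
  2 * x + 2 * y    ≤⟨ +-mono-≤ (*-monoˡ-≤ x b≥2) (*-monoˡ-≤ y a≥2) ⟩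
  b * x + a * y    ≡⟨ cong₂ _+_ bx≡c ay≡c ⟩
  c + c            ≡⟨ cong (c +_) (+-identityʳ c) ⟨
  2 * c            ∎)
  where open ≤-Reasoning

hub-degree≡1 : ∀ {D c s z} → D * c ≡ s + z → s ≤ c → z < c → 1 ≤ D → D ≡ 1
hub-degree≡1 {D} {c} {s} {z} Dc≡s+z s≤c z<c 1≤D = ≤-antisym (s≤s⁻¹ (*-cancelʳ-< c D 2 (begin-strict
  D * c      ≡⟨ Dc≡s+z ⟩
  s + z      <⟨ +-mono-≤-< s≤c z<c ⟩
  c + c      ≡⟨ cong (c +_) (+-identityʳ c) ⟨
  2 * c      ∎))) 1≤D
  where open ≤-Reasoning

arithmetical⇒smoothPath : ∀ {ℓ} {d r : Vert ℓ → ℕ} → (∀ v → 1 ≤ r v) → (∀ v → d v * r v ≡ Ar r v) →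
                          (∀ i → 1 ≤ toℕ i → 2 ≤ d (vp i)) → SmoothPath ℓ (onPath r) (onPath d)
arithmetical⇒smoothPath {ℓ} {d} {r} r≥1 balance d≥2 = record
  { positive  = λ m≤ℓ → subst (0 <_) (sym (zeroExtend-< (r ∘ vp) (s≤s m≤ℓ))) (r≥1 _)
  ; vanishing = zeroExtend-≥ (r ∘ vp)
  ; balanced  = balanced
  ; smooth    = λ m<ℓ → subst (2 ≤_) (sym (zeroExtend-< (d ∘ vp ∘ Fin.suc) m<ℓ)) (d≥2 _ (s≤s z≤n))
  }
  where
  balanced : ∀ {m} → suc m ≤ ℓ → onPath d (suc m) * onPath r (suc m) ≡ onPath r (2 + m) + onPath r m
  balanced {m} m<ℓ = begin
    onPath d (suc m) * onPath r (suc m)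
      ≡⟨ cong₂ _*_ (zeroExtend-< (d ∘ vp ∘ Fin.suc) m<ℓ) (zeroExtend-< (r ∘ vp ∘ Fin.suc) m<ℓ) ⟩
    d (vp (Fin.suc j)) * r (vp (Fin.suc j))  ≡⟨ balance (vp (Fin.suc j)) ⟩
    Ar r (vp (Fin.suc j))                    ≡⟨ Ar-vsuc r j ⟩
    onPath r (2 + toℕ j) + onPath r (toℕ j)  ≡⟨ cong (λ k → onPath r (2 + k) + onPath r k) (toℕ-fromℕ< m<ℓ) ⟩
    onPath r (2 + m) + onPath r m            ∎
    where
    open ≡-Reasoning
    j = fromℕ< m<ℓ

-- The consequences of smoothness and r̄ = (a, b) from which the structure is recovered.
record Normalised (a b ℓ : ℕ) (d r : Vert ℓ → ℕ) : Set where
  field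
    path    : SmoothPath ℓ (onPath r) (onPath d)
    d-vx    : d vx ≡ b
    d-vy    : d vy ≡ a
    d-v₀    : d (vp Fin.zero) ≡ 1
    hub     : onPath r 0 ≡ r vx + (r vy + onPath r 1)
    bx≡r₀   : b * r vx ≡ onPath r 0
    ay≡r₀   : a * r vy ≡ onPath r 0
    coprime : Coprime (r vx) (r vy)

normalise : ∀ {a b ℓ} {d r : Vert ℓ → ℕ} → 2 ≤ a → 2 ≤ b → Good a b ℓ d r → Normalised a b ℓ d r
normalise {a} {b} {ℓ} {d} {r} a≥2 b≥2 ((d≥1 , r≥1 , balance , r-primitive) , (_ , _ , d≥2) , ay≡r₀ , bx≡r₀) =
  record { path = path ; d-vx = d-vx ; d-vy = d-vy ; d-v₀ = d-v₀ ; hub = hub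
         ; bx≡r₀ = bx≡r₀ ; ay≡r₀ = ay≡r₀ ; coprime = coprime }
  where
  path : SmoothPath ℓ (onPath r) (onPath d)
  path = arithmetical⇒smoothPath {d = d} r≥1 balance d≥2

  d-vx : d vx ≡ b
  d-vx = *-cancelʳ-≡ (d vx) b (r vx) {{>-nonZero (r≥1 vx)}} (trans (balance vx) (trans (Ar-vx r) (sym bx≡r₀)))

  d-vy : d vy ≡ a
  d-vy = *-cancelʳ-≡ (d vy) a (r vy) {{>-nonZero (r≥1 vy)}} (trans (balance vy) (trans (Ar-vy r) (sym ay≡r₀)))

  balance₀ : d (vp Fin.zero) * onPath r 0 ≡ r vx + (r vy + onPath r 1)
  balance₀ = trans (balance (vp Fin.zero)) (Ar-v₀ r)

  d-v₀ : d (vp Fin.zero) ≡ 1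
  d-v₀ = hub-degree≡1 (trans balance₀ (sym (+-assoc (r vx) (r vy) _)))
           (leaves≤hub a≥2 b≥2 bx≡r₀ ay≡r₀) (decreasing path z≤n) (d≥1 (vp Fin.zero))

  hub : onPath r 0 ≡ r vx + (r vy + onPath r 1)
  hub = trans (sym (*-identityˡ (onPath r 0))) (trans (cong (_* onPath r 0) (sym d-v₀)) balance₀)

  coprime : Coprime (r vx) (r vy)
  coprime {k} (k∣x , k∣y) = r-primitive k k∣r
    where
    k∣r₀ : k ∣ onPath r 0
    k∣r₀ = subst (k ∣_) bx≡r₀ (∣n⇒∣m*n b k∣x)
    k∣r₁ : k ∣ onPath r 1
    k∣r₁ = ∣m+n∣m⇒∣n (∣m+n∣m⇒∣n (subst (k ∣_) hub k∣r₀) k∣x) k∣y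
    k∣r : ∀ v → k ∣ r v
    k∣r vx     = k∣x
    k∣r vy     = k∣y
    k∣r (vp j) = subst (k ∣_) (zeroExtend-toℕ (r ∘ vp) j) (∣-everywhere path k∣r₀ k∣r₁ (toℕ j))

coprime-proportional : ∀ {x₁ y₁ x₂ y₂} → Coprime x₁ y₁ → Coprime x₂ y₂ → x₁ * y₂ ≡ x₂ * y₁ → x₁ ≡ x₂
coprime-proportional {x₁} {y₁} {x₂} {y₂} coprime₁ coprime₂ x₁y₂≡x₂y₁ = ∣-antisym
  (coprime-divisor coprime₁ (divides y₂ (trans (*-comm y₁ x₂) (trans (sym x₁y₂≡x₂y₁) (*-comm x₁ y₂)))))
  (coprime-divisor coprime₂ (divides y₁ (trans (*-comm y₂ x₁) (trans x₁y₂≡x₂y₁ (*-comm x₂ y₁)))))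

module Normalised-unique {a b ℓ₁ ℓ₂ : ℕ} {d₁ r₁ : Vert ℓ₁ → ℕ} {d₂ r₂ : Vert ℓ₂ → ℕ}
                         .{{_ : NonZero a}} .{{_ : NonZero b}}
                         (N₁ : Normalised a b ℓ₁ d₁ r₁) (N₂ : Normalised a b ℓ₂ d₂ r₂) where
  private
    module N₁ = Normalised N₁
    module N₂ = Normalised N₂
    instance
      ba≢0 : NonZero (b * a)
      ba≢0 = m*n≢0 b a

  vx-unique : r₁ vx ≡ r₂ vx
  vx-unique = coprime-proportional N₁.coprime N₂.coprime (*-cancelˡ-≡ _ _ (b * a) (begin
    b * a * (x₁ * y₂)    ≡⟨ *-interchange b x₁ a y₂ ⟨
    b * x₁ * (a * y₂)    ≡⟨ cong₂ _*_ (trans N₁.bx≡r₀ (sym N₁.ay≡r₀)) (trans N₂.ay≡r₀ (sym N₂.bx≡r₀)) ⟩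
    a * y₁ * (b * x₂)    ≡⟨ *-comm (a * y₁) (b * x₂) ⟩
    b * x₂ * (a * y₁)    ≡⟨ *-interchange b x₂ a y₁ ⟩
    b * a * (x₂ * y₁)    ∎))
    where
    open ≡-Reasoning
    *-interchange : ∀ w x y z → w * x * (y * z) ≡ w * y * (x * z)
    *-interchange = interchange *-commutativeSemigroup
    x₁ = r₁ vx
    y₁ = r₁ vy
    x₂ = r₂ vx
    y₂ = r₂ vy

  v₀-unique : onPath r₁ 0 ≡ onPath r₂ 0
  v₀-unique = trans (sym N₁.bx≡r₀) (trans (cong (b *_) vx-unique) N₂.bx≡r₀)

  vy-unique : r₁ vy ≡ r₂ vy
  vy-unique = *-cancelˡ-≡ _ _ a (trans N₁.ay≡r₀ (trans v₀-unique (sym N₂.ay≡r₀)))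

  v₁-unique : onPath r₁ 1 ≡ onPath r₂ 1
  v₁-unique = +-cancelˡ-≡ (r₁ vy) _ _ (+-cancelˡ-≡ (r₁ vx) _ _ (begin
    r₁ vx + (r₁ vy + onPath r₁ 1)  ≡⟨ N₁.hub ⟨
    onPath r₁ 0                    ≡⟨ v₀-unique ⟩
    onPath r₂ 0                    ≡⟨ N₂.hub ⟩
    r₂ vx + (r₂ vy + onPath r₂ 1)  ≡⟨ cong₂ (λ x y → x + (y + onPath r₂ 1)) vx-unique vy-unique ⟨
    r₁ vx + (r₁ vy + onPath r₂ 1)  ∎))
    where open ≡-Reasoning

  open SmoothPath-unique N₁.path N₂.path v₀-unique v₁-unique
    renaming (R₁≗R₂ to onPath-r-unique; ℓ₁≡ℓ₂ to length-unique; D₁≡D₂ to degrees-unique)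
    public

  onPath-d-unique : onPath d₁ ≗ onPath d₂
  onPath-d-unique zero = trans N₁.d-v₀ (sym N₂.d-v₀)
  onPath-d-unique (suc m) with suc m ≤? ℓ₁
  ... | yes 1+m≤ℓ₁ = degrees-unique 1+m≤ℓ₁
  ... | no  1+m≰ℓ₁ = trans (zeroExtend-≥ (d₁ ∘ vp) ℓ₁<1+m)
                           (sym (zeroExtend-≥ (d₂ ∘ vp) (subst (_< suc m) length-unique ℓ₁<1+m)))
    where
    ℓ₁<1+m : ℓ₁ < suc m
    ℓ₁<1+m = ≰⇒> 1+m≰ℓ₁

normalised-unique : ∀ {a b ℓ} {d₁ r₁ d₂ r₂ : Vert ℓ → ℕ} .{{_ : NonZero a}} .{{_ : NonZero b}} →
                    Normalised a b ℓ d₁ r₁ → Normalised a b ℓ d₂ r₂ →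
                    (∀ v → d₁ v ≡ d₂ v) × (∀ v → r₁ v ≡ r₂ v)
normalised-unique N₁ N₂ =
  Vert-ext (trans N₁.d-vx (sym N₂.d-vx)) (trans N₁.d-vy (sym N₂.d-vy)) onPath-d-unique ,
  Vert-ext vx-unique vy-unique onPath-r-unique
  where
  open Normalised-unique N₁ N₂
  module N₁ = Normalised N₁
  module N₂ = Normalised N₂

bidentR : ∀ {ℓ} → ℕ → ℕ → (ℕ → ℕ) → Vert ℓ → ℕ
bidentR x y R vx     = x
bidentR x y R vy     = y
bidentR x y R (vp j) = R (toℕ j)

bidentD : ∀ {ℓ} → ℕ → ℕ → (ℕ → ℕ) → Vert ℓ → ℕ
bidentD dx dy D vx               = dx
bidentD dx dy D vy               = dy
bidentD dx dy D (vp Fin.zero)    = 1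
bidentD dx dy D (vp (Fin.suc j)) = D (suc (toℕ j))

assemble : ∀ {a b x y ℓ R D} → 2 ≤ a → 2 ≤ b → 1 ≤ x → 1 ≤ y → Coprime x y → b * x ≡ a * y →
           SmoothPath ℓ R D → R 0 ≡ b * x → R 0 ≡ x + (y + R 1) →
           Good a b ℓ (bidentD b a D) (bidentR x y R)
assemble {a} {b} {x} {y} {ℓ} {R} {D} a≥2 b≥2 x≥1 y≥1 coprime bx≡ay C R₀≡bx hub =
  (d≥1 , r≥1 , balance , r-primitive) , (b≥2 , a≥2 , d≥2) , trans (sym bx≡ay) (sym R₀≡bx) , sym R₀≡bx
  where
  open SmoothPath C
  r = bidentR {ℓ} x y R
  d = bidentD {ℓ} b a D

  onPath-r : onPath r ≗ R
  onPath-r = zeroExtend-restrict R vanishing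

  d≥1 : ∀ v → 1 ≤ d v
  d≥1 vx               = <⇒≤ b≥2
  d≥1 vy               = <⇒≤ a≥2
  d≥1 (vp Fin.zero)    = s≤s z≤n
  d≥1 (vp (Fin.suc j)) = <⇒≤ (smooth (toℕ<n j))

  r≥1 : ∀ v → 1 ≤ r v
  r≥1 vx     = x≥1
  r≥1 vy     = y≥1
  r≥1 (vp j) = positive (s≤s⁻¹ (toℕ<n j))

  d≥2 : ∀ i → 1 ≤ toℕ i → 2 ≤ d (vp i)
  d≥2 (Fin.suc j) _ = smooth (toℕ<n j)

  balance : ∀ v → d v * r v ≡ Ar r v
  balance vx = sym (trans (Ar-vx r) R₀≡bx)
  balance vy = trans (sym bx≡ay) (trans (sym R₀≡bx) (sym (Ar-vy r)))
  balance (vp Fin.zero) = begin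
    1 * R 0                 ≡⟨ *-identityˡ (R 0) ⟩
    R 0                     ≡⟨ hub ⟩
    x + (y + R 1)           ≡⟨ cong (λ t → x + (y + t)) (onPath-r 1) ⟨
    x + (y + onPath r 1)    ≡⟨ Ar-v₀ r ⟨
    Ar r (vp Fin.zero)      ∎
    where open ≡-Reasoning
  balance (vp (Fin.suc j)) = begin
    D (suc (toℕ j)) * R (suc (toℕ j))        ≡⟨ balanced (toℕ<n j) ⟩
    R (2 + toℕ j) + R (toℕ j)                ≡⟨ cong₂ _+_ (onPath-r (2 + toℕ j)) (onPath-r (toℕ j)) ⟨
    onPath r (2 + toℕ j) + onPath r (toℕ j)  ≡⟨ Ar-vsuc r j ⟨
    Ar r (vp (Fin.suc j))                    ∎
    where open ≡-Reasoning

  r-primitive : Primitive r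
  r-primitive k k∣r = coprime (k∣r vx , k∣r vy)

good-exists : ∀ {a b} → 2 ≤ a → 2 ≤ b → Σ ℕ λ ℓ → Σ (Vert ℓ → ℕ) λ d → Σ (Vert ℓ → ℕ) λ r → Good a b ℓ d r
good-exists {a} {b} a≥2 b≥2 = from-path (smoothPath-exists (b * x ∸ (x + y)) r₁<r₀)
  where
  instance
    a≢0 : NonZero a
    a≢0 = >-nonZero (<⇒≤ a≥2)
    b≢0 : NonZero b
    b≢0 = >-nonZero (<⇒≤ b≥2)
    g≢0 : NonZero (gcd a b)
    g≢0 = ≢-nonZero (gcd[m,n]≢0 a b (inj₁ (≢-nonZero⁻¹ a)))

  x = a / gcd a b
  y = b / gcd a b

  bx≡ay : b * x ≡ a * y
  bx≡ay = begin
    b * (a / gcd a b)   ≡⟨ *-/-assoc b (gcd[m,n]∣m a b) ⟨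
    b * a / gcd a b     ≡⟨ cong (_/ gcd a b) (*-comm b a) ⟩
    a * b / gcd a b     ≡⟨ *-/-assoc a (gcd[m,n]∣n a b) ⟩
    a * (b / gcd a b)   ∎
    where open ≡-Reasoning

  x≥1 : 1 ≤ x
  x≥1 = n≢0⇒n>0 (m/gcd[m,n]≢0 a b)

  x+y≤bx : x + y ≤ b * x
  x+y≤bx = leaves≤hub a≥2 b≥2 refl (sym bx≡ay)

  r₁<r₀ : b * x ∸ (x + y) < b * x
  r₁<r₀ = ∸-monoʳ-< (≤-trans x≥1 (m≤m+n x y)) x+y≤bx

  from-path : SmoothPathFrom (b * x) (b * x ∸ (x + y)) →
              Σ ℕ λ ℓ → Σ (Vert ℓ → ℕ) λ d → Σ (Vert ℓ → ℕ) λ r → Good a b ℓ d r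
  from-path (ℓ , R , D , C , R₀≡bx , R₁≡bx∸[x+y]) =
    ℓ , _ , _ , assemble a≥2 b≥2 x≥1 (n≢0⇒n>0 (n/gcd[m,n]≢0 a b)) (coprime-/gcd a b) bx≡ay C R₀≡bx (begin
      R 0                            ≡⟨ R₀≡bx ⟩
      b * x                          ≡⟨ m+[n∸m]≡n x+y≤bx ⟨
      x + y + (b * x ∸ (x + y))      ≡⟨ +-assoc x y _ ⟩
      x + (y + (b * x ∸ (x + y)))    ≡⟨ cong (λ t → x + (y + t)) R₁≡bx∸[x+y] ⟨
      x + (y + R 1)                  ∎)
    where open ≡-Reasoning

proposition3p1 : (a b : ℕ) → 2 ≤ a → 2 ≤ b →
    Σ ℕ (λ ℓ → Σ (Vert ℓ → ℕ) (λ d → Σ (Vert ℓ → ℕ) (λ r →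
      Good a b ℓ d r
      × (∀ ℓ' (d' r' : Vert ℓ' → ℕ) → Good a b ℓ' d' r' → ℓ' ≡ ℓ)
      × (∀ (d' r' : Vert ℓ → ℕ) → Good a b ℓ d' r' →
           (∀ v → d' v ≡ d v) × (∀ v → r' v ≡ r v)))))
proposition3p1 a b a≥2 b≥2 =
  let ℓ , d , r , G = good-exists a≥2 b≥2
  in  ℓ , d , r , G
    , (λ _ _ _ G′ → Normalised-unique.length-unique (normalise′ G′) (normalise′ G))
    , (λ _ _ G′ → normalised-unique (normalise′ G′) (normalise′ G))
  where
  instance
    a≢0 : NonZero a
    a≢0 = >-nonZero (<⇒≤ a≥2)
    b≢0 : NonZero b
    b≢0 = >-nonZero (<⇒≤ b≥2)
  normalise′ : ∀ {ℓ} {d r : Vert ℓ → ℕ} → Good a b ℓ d r → Normalised a b ℓ d r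
  normalise′ = normalise a≥2 b≥2
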